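{- Let $\mathcal{B}$ be an admissible Bar Code with $n$ rows. Then: (a) $l_{n-1}(B^{(n)}_1)\ge l_{n-1}(B^{(n)}_2)\ge\dots\ge l_{n-1}(B^{(n)}_{\mu(n)})$; (b) for every $1\le i\le n-2$ and every $(i+2)$-bar $B^{(i+2)}_j$, if $B^{(i+1)}_{j_1},B^{(i+1)}_{j_1+1},\dots,B^{(i+1)}_{j_1+h}$ are the $(i+1)$-bars lying over $B^{(i+2)}_j$ (from left to right), then $l_i(B^{(i+1)}_{j_1})\ge l_i(B^{(i+1)}_{j_1+1})\ge\dots\ge l_i(B^{(i+1)}_{j_1+h})$.
   Context: An (abstract) Bar Code with $n$ rows on the column set $\{1,\dots,m\}$ is a sequence $R_1,\dots,R_n$ of partitions of $\{1,\dots,m\}$ into intervals of consecutive integers (the intervals of $R_i$ are called $i$-bars, numbered $B^{(i)}_1,\dots,B^{(i)}_{\mu(i)}$ from left to right), such that every $1$-bar is a single column and every $i$-bar ($i<n$) is contained in an $(i+1)$-bar. A bar of row $i'$ lies over a bar of row $i>i'$ if it is contained in it. For a bar $B$ of row $i$ and $k<i$, $l_k(B)$ denotes the number of $k$-bars lying over $B$. The e-list of column $c$ is $e(c)=(b_{c,1},\dots,b_{c,n})$ where $b_{c,n}$ is the number of $n$-bars strictly to the left of the $n$-bar containing $c$, and for $1\le i\le n-1$, $b_{c,i}$ is the number of $i$-bars contained in the $(i+1)$-bar containing $c$ that lie strictly to the left of the $i$-bar containing $c$. $\mathcal{B}$ is admissible if the set of terms $\{x_1^{b_{c,1}}\cdots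 x_n^{b_{c,n}} : 1\le c\le m\}$ is an order ideal (closed under divisors). -}

module Defs where

open import Data.Nat using (ℕ; zero; suc; _+_; _∸_; _≤_; _<_; _≤?_; _<?_)
open import Data.Nat.Properties using (_≟_)
open import Data.Product using (_×_; _,_; proj₁; proj₂; Σ; ∃-syntax)
open import Data.List using (List; []; _∷_; length; filter; map)
open import Data.Nat.ListAction using (sum)
open import Data.List.Relation.Unary.All using (All)
open import Data.List.Relation.Unary.Any using (Any; any?)
open import Data.List.Relation.Unary.Linked using (Linked)
open import Relation.Nullary using (Dec; yes; no)
open import Relation.Nullary.Decidable using (_×-dec_)
open import Relation.Binary.PropositionalEquality using (_≡_)

-- A bar is an interval of columns, stored as (first column , length);
-- it consists of the columns  start , start+1 , … , start+len-1.
Bar : Set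
Bar = ℕ × ℕ

start : Bar → ℕ
start = proj₁

-- one past the last column of the bar
end : Bar → ℕ
end B = proj₁ B + proj₂ B

intervals : ℕ → List ℕ → List Bar
intervals s [] = []
intervals s (l ∷ ls) = (s , l) ∷ intervals (s + l) ls

_⊆B_ : Bar → Bar → Set
B ⊆B D = start D ≤ start B × end B ≤ end D

_⊆B?_ : (B D : Bar) → Dec (B ⊆B D)
B ⊆B? D = (start D ≤? start B) ×-dec (end B ≤? end D)

_∈B_ : ℕ → Bar → Set
c ∈B D = start D ≤ c × c < end D

_∈B?_ : (c : ℕ) (D : Bar) → Dec (c ∈B D)
c ∈B? D = (start D ≤? c) ×-dec (c <? end D)

-- An abstract Bar Code with n rows (numbered 1..n) on columns {1,…,m}.
-- Row i is given by the list of lengths of its bars, from left to right;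
-- the values of  row i  for i outside 1..n are irrelevant.
record BarCode (n m : ℕ) : Set where
  field
    row : ℕ → List ℕ
    row-pos : ∀ i → 1 ≤ i → i ≤ n → All (λ l → 1 ≤ l) (row i)
    row-sum : ∀ i → 1 ≤ i → i ≤ n → sum (row i) ≡ m
    row-one : 1 ≤ n → All (λ l → l ≡ 1) (row 1)
    nested : ∀ i → 1 ≤ i → i < n →
      All (λ B → Any (λ D → B ⊆B D) (intervals 1 (row (suc i))))
          (intervals 1 (row i))

  bars : ℕ → List Bar
  bars i = intervals 1 (row i)

  l : ℕ → Bar → ℕ
  l k B = length (filter (λ B' → B' ⊆B? B) (bars k))

  barsOver : ℕ → Bar → List Bar
  barsOver i D = filter (λ B → B ⊆B? D) (bars i)

  e : ℕ → ℕ → ℕ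
  e c i with i ≟ n
  ... | yes _ =
    length (filter (λ B → end B ≤? c) (bars n))
  ... | no _ =
    -- number of i-bars contained in the (i+1)-bar containing c that lie
    -- strictly to the left of the i-bar containing c
    length (filter (λ B → (end B ≤? c) ×-dec
                          any? (λ D → (c ∈B? D) ×-dec (B ⊆B? D)) (bars (suc i)))
                   (bars i))

  -- admissibility: {x^{e(c)} : 1 ≤ c ≤ m} is an order ideal, i.e. closed
  -- under divisors (componentwise ≤ of exponent vectors)
  Admissible : Set
  Admissible =
    ∀ c → 1 ≤ c → c ≤ m → (v : ℕ → ℕ) →
    (∀ i → 1 ≤ i → i ≤ n → v i ≤ e c i) →
    ∃[ c' ] (1 ≤ c' × c' ≤ m × (∀ i → 1 ≤ i → i ≤ n → e c' i ≡ v i))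

-- Order exponent vectors reverse-lexicographically (row n first). Then c ↦ e(c) is monotone, and
-- e(c) agrees on all rows i ≥ j for columns c lying in a common j-bar. Let P, Q be (r+1)-bars, P left
-- of Q, over a common (r+2)-bar, with last columns p and q, and suppose l_r(P) < l_r(Q). All but one
-- r-bar of Q lie left of q, so e_r(q) ≥ l_r(P), and the vector v equal to e(p) above row r, to l_r(P)
-- at row r and to 0 below divides x^e(q). By admissibility v = e(c') for some column c'. But
-- e_r(p) < l_r(P) gives e(p) < v, and p + 1 starting a new (r+1)-bar gives v < e(p + 1): no column
-- lies strictly between p and p + 1.

module Submission where

open import Defs
open import Data.Nat using (ℕ; suc; _+_; _∸_; _≤_; _≥_)
open import Data.Product using (_×_)
open import Data.List using (map)
open import Data.List.Relation.Unary.All using (All)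
open import Data.List.Relation.Unary.Linked using (Linked)

open import Data.Nat using (z≤n; s≤s; _<_; _≤′_; ≤′-refl; ≤′-step; _≤?_)
open import Data.Nat.Properties
open import Data.Nat.ListAction using (sum)
open import Data.Product using (Σ; _,_; proj₁; proj₂)
open import Data.Sum using (_⊎_; inj₁; inj₂)
open import Data.Empty using (⊥; ⊥-elim)
open import Data.List using (List; []; _∷_; length; filter)
open import Data.List.Properties using (filter-none; filter-accept; filter-reject)
open import Data.List.Membership.Propositional using (_∈_; find; lose)
open import Data.List.Membership.Propositional.Properties using (∈-filter⁻)
open import Data.List.Relation.Unary.Any using (Any; here; there; any?)
open import Data.List.Relation.Unary.All using (_∷_; tabulate)
import Data.List.Relation.Unary.All as All
open import Data.List.Relation.Unary.AllPairs using (AllPairs; []; _∷_)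
import Data.List.Relation.Unary.AllPairs.Properties as AllPairs
open import Data.List.Relation.Unary.Linked using ([]; [-]; _∷_)
open import Relation.Nullary using (¬_; yes; no)
open import Relation.Nullary.Decidable using (_×-dec_)
open import Relation.Unary using (Decidable)
open import Relation.Binary using (tri<; tri≈; tri>)
open import Relation.Binary.PropositionalEquality
  using (_≡_; _≢_; refl; sym; trans; cong; subst)

module _ {A : Set} {P Q : A → Set} (P? : Decidable P) (Q? : Decidable Q) where

  length-filter-mono : ∀ xs → (∀ {x} → x ∈ xs → P x → Q x) →
    length (filter P? xs) ≤ length (filter Q? xs)
  length-filter-mono [] P⇒Q = z≤n
  length-filter-mono (x ∷ xs) P⇒Q with P? x | Q? x
  ... | yes _  | yes _  = s≤s (length-filter-mono xs (λ m → P⇒Q (there m)))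
  ... | yes px | no ¬qx = ⊥-elim (¬qx (P⇒Q (here refl) px))
  ... | no _   | yes _  = m≤n⇒m≤1+n (length-filter-mono xs (λ m → P⇒Q (there m)))
  ... | no _   | no _   = length-filter-mono xs (λ m → P⇒Q (there m))

  length-filter-< : ∀ xs → (∀ {x} → x ∈ xs → P x → Q x) →
    ∀ {y} → y ∈ xs → Q y → ¬ P y → length (filter P? xs) < length (filter Q? xs)
  length-filter-< (x ∷ xs) P⇒Q (here refl) qy ¬py with P? x | Q? x
  ... | yes px | _      = ⊥-elim (¬py px)
  ... | no _   | yes _  = s≤s (length-filter-mono xs (λ m → P⇒Q (there m)))
  ... | no _   | no ¬qy = ⊥-elim (¬qy qy)
  length-filter-< (x ∷ xs) P⇒Q (there y∈) qy ¬py with P? x | Q? x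
  ... | yes _  | yes _  = s≤s (length-filter-< xs (λ m → P⇒Q (there m)) y∈ qy ¬py)
  ... | yes px | no ¬qx = ⊥-elim (¬qx (P⇒Q (here refl) px))
  ... | no _   | yes _  = m≤n⇒m≤1+n (length-filter-< xs (λ m → P⇒Q (there m)) y∈ qy ¬py)
  ... | no _   | no _   = length-filter-< xs (λ m → P⇒Q (there m)) y∈ qy ¬py

  length-filter-⊎ : ∀ {R : A → Set} (R? : Decidable R) xs → (∀ {x} → x ∈ xs → P x → Q x ⊎ R x) →
    length (filter P? xs) ≤ length (filter Q? xs) + length (filter R? xs)
  length-filter-⊎ R? [] P⇒Q⊎R = z≤n
  length-filter-⊎ R? (x ∷ xs) P⇒Q⊎R
    with P? x | Q? x | R? x | length-filter-⊎ R? xs (λ m → P⇒Q⊎R (there m))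
  ... | no _  | no _  | no _  | ih = ih
  ... | no _  | yes _ | no _  | ih = m≤n⇒m≤1+n ih
  ... | no _  | no _  | yes _ | ih = ≤-trans ih (+-monoʳ-≤ _ (n≤1+n _))
  ... | no _  | yes _ | yes _ | ih = m≤n⇒m≤1+n (≤-trans ih (+-monoʳ-≤ _ (n≤1+n _)))
  ... | yes _ | yes _ | no _  | ih = s≤s ih
  ... | yes _ | yes _ | yes _ | ih = s≤s (≤-trans ih (+-monoʳ-≤ _ (n≤1+n _)))
  ... | yes _ | no _  | yes _ | ih = ≤-trans (s≤s ih) (≤-reflexive (sym (+-suc _ _)))
  ... | yes px | no ¬qx | no ¬rx | _ with P⇒Q⊎R (here refl) px
  ...   | inj₁ qx = ⊥-elim (¬qx qx)
  ...   | inj₂ rx = ⊥-elim (¬rx rx)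

linked-map : ∀ {A : Set} {R : A → A → Set} (f : A → ℕ) (xs : List A) → AllPairs R xs →
  (∀ {x y} → x ∈ xs → y ∈ xs → R x y → f y ≤ f x) → Linked _≥_ (map f xs)
linked-map f [] _ _ = []
linked-map f (x ∷ []) _ _ = [-]
linked-map f (x ∷ y ∷ zs) (Rx ∷ Rzs) antitone =
  antitone (here refl) (there (here refl)) (All.head Rx) ∷
  linked-map f (y ∷ zs) Rzs (λ x∈ y∈ → antitone (there x∈) (there y∈))

truncateAt : ℕ → ℕ → (ℕ → ℕ) → ℕ → ℕ
truncateAt r x f i with <-cmp i r
... | tri< _ _ _ = 0
... | tri≈ _ _ _ = x
... | tri> _ _ _ = f i

truncateAt-≡ : ∀ {r x f} → truncateAt r x f r ≡ x
truncateAt-≡ {r} with <-cmp r r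
... | tri< _ r≢r _ = ⊥-elim (r≢r refl)
... | tri≈ _ _ _ = refl
... | tri> _ r≢r _ = ⊥-elim (r≢r refl)

truncateAt-> : ∀ {r x f i} → r < i → truncateAt r x f i ≡ f i
truncateAt-> {r} {i = i} r<i with <-cmp i r
... | tri< _ _ ¬r<i = ⊥-elim (¬r<i r<i)
... | tri≈ _ _ ¬r<i = ⊥-elim (¬r<i r<i)
... | tri> _ _ _ = refl

∈B-⊆B : ∀ {c B D} → c ∈B B → B ⊆B D → c ∈B D
∈B-⊆B (B≤c , c<B) (D≤B , B≤D) = ≤-trans D≤B B≤c , <-≤-trans c<B B≤D

⊆B-trans : ∀ {B C D} → B ⊆B C → C ⊆B D → B ⊆B D
⊆B-trans (C≤B , B≤C) (D≤C , C≤D) = ≤-trans D≤C C≤B , ≤-trans B≤C C≤D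

∈B-between : ∀ {c x c' D} → c ∈B D → c' ∈B D → c ≤ x → x ≤ c' → x ∈B D
∈B-between (D≤c , _) (_ , c'<D) c≤x x≤c' = ≤-trans D≤c c≤x , ≤-<-trans x≤c' c'<D

intervals-start : ∀ {s L B} → B ∈ intervals s L → s ≤ start B
intervals-start {s} {l ∷ L} (here refl) = ≤-refl
intervals-start {s} {l ∷ L} (there B∈) = ≤-trans (m≤m+n s l) (intervals-start B∈)

intervals-end : ∀ {s L B} → B ∈ intervals s L → end B ≤ s + sum L
intervals-end {s} {l ∷ L} (here refl) = +-monoʳ-≤ s (m≤m+n l (sum L))
intervals-end {s} {l ∷ L} (there B∈) =
  ≤-trans (intervals-end B∈) (≤-reflexive (+-assoc s l (sum L)))

intervals-nonempty : ∀ {s L B} → All (1 ≤_) L → B ∈ intervals s L → 1 ≤ proj₂ B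
intervals-nonempty {L = _ ∷ _} (1≤l ∷ _) (here refl) = 1≤l
intervals-nonempty {L = _ ∷ _} (_ ∷ 1≤L) (there B∈) = intervals-nonempty 1≤L B∈

intervals-sorted : ∀ {s L} → AllPairs (λ B B' → end B ≤ start B') (intervals s L)
intervals-sorted {s} {[]} = []
intervals-sorted {s} {l ∷ L} = tabulate intervals-start ∷ intervals-sorted

intervals-disjoint : ∀ {s L B B' c} → B ∈ intervals s L → B' ∈ intervals s L →
  c ∈B B → c ∈B B' → B ≡ B'
intervals-disjoint {L = _ ∷ _} (here refl) (here refl) _ _ = refl
intervals-disjoint {L = _ ∷ _} (here refl) (there B'∈) (_ , c<B) (B'≤c , _) =
  ⊥-elim (<⇒≱ c<B (≤-trans (intervals-start B'∈) B'≤c))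
intervals-disjoint {L = _ ∷ _} (there B∈) (here refl) (B≤c , _) (_ , c<B') =
  ⊥-elim (<⇒≱ c<B' (≤-trans (intervals-start B∈) B≤c))
intervals-disjoint {L = _ ∷ _} (there B∈) (there B'∈) cB cB' = intervals-disjoint B∈ B'∈ cB cB'

intervals-cover : ∀ {s L c} → s ≤ c → c < s + sum L → Σ Bar λ B → B ∈ intervals s L × c ∈B B
intervals-cover {s} {[]} s≤c c<s+0 = ⊥-elim (<⇒≱ c<s+0 (≤-trans (≤-reflexive (+-identityʳ s)) s≤c))
intervals-cover {s} {l ∷ L} {c} s≤c c<end with c <? s + l
... | yes c<s+l = (s , l) , here refl , s≤c , c<s+l
... | no c≮s+l with intervals-cover {s + l} {L} (≮⇒≥ c≮s+l)
                      (<-≤-trans c<end (≤-reflexive (sym (+-assoc s l (sum L)))))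
...   | B , B∈ , cB = B , there B∈ , cB

intervals-end-unique : ∀ {s L} t → All (1 ≤_) L →
  length (filter (λ B → end B ≟ t) (intervals s L)) ≤ 1
intervals-end-unique {s} {[]} t _ = z≤n
intervals-end-unique {s} {l ∷ L} t (_ ∷ 1≤L) with s + l ≟ t
... | no s+l≢t = subst (λ Bs → length Bs ≤ 1)
      (sym (filter-reject (λ B → end B ≟ t) {s , l} {intervals (s + l) L} s+l≢t))
      (intervals-end-unique {s + l} t 1≤L)
... | yes refl = subst (λ Bs → length Bs ≤ 1)
      (sym (filter-accept (λ B → end B ≟ (s + l)) {s , l} {intervals (s + l) L} refl))
      (s≤s (≤-reflexive (cong length (filter-none (λ B → end B ≟ (s + l))
        (tabulate (λ B∈ end≡ → <-irrefl (sym end≡) (later B∈)))))))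
  where
  later : ∀ {B} → B ∈ intervals (s + l) L → s + l < end B
  later B∈ = ≤-<-trans (intervals-start B∈) (m<m+n _ (intervals-nonempty 1≤L B∈))

module BarCodeProperties {n m : ℕ} (𝓑 : BarCode n m) where
  open BarCode 𝓑

  bar-last-column : ∀ {i B} → 1 ≤ i → i ≤ n → B ∈ bars i → Σ ℕ λ x → suc x ≡ end B × x ∈B B
  bar-last-column {i} {b , len} 1≤i i≤n B∈
    with len | intervals-nonempty (row-pos i 1≤i i≤n) B∈
  ... | suc k | _ = b + k , sym (+-suc b k) , m≤m+n b k , ≤-reflexive (sym (+-suc b k))

  bar-end : ∀ {i B} → 1 ≤ i → i ≤ n → B ∈ bars i → end B ≤ suc m
  bar-end {i} 1≤i i≤n B∈ = subst (λ k → _ ≤ suc k) (row-sum i 1≤i i≤n) (intervals-end B∈)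

  column-bar : ∀ {i c} → 1 ≤ i → i ≤ n → 1 ≤ c → c ≤ m → Σ Bar λ B → B ∈ bars i × c ∈B B
  column-bar {i} 1≤i i≤n 1≤c c≤m =
    intervals-cover 1≤c (subst (λ k → _ < suc k) (sym (row-sum i 1≤i i≤n)) (s≤s c≤m))

  bar-parent : ∀ {i B} → 1 ≤ i → i < n → B ∈ bars i → Σ Bar λ D → D ∈ bars (suc i) × B ⊆B D
  bar-parent {i} 1≤i i<n B∈ = find (All.lookup (nested i 1≤i i<n) B∈)

  bar-ancestor : ∀ {i j B} → 1 ≤ i → i ≤′ j → j ≤ n → B ∈ bars i →
    Σ Bar λ D → D ∈ bars j × B ⊆B D
  bar-ancestor {B = B} 1≤i ≤′-refl j≤n B∈ = B , B∈ , ≤-refl , ≤-refl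
  bar-ancestor {j = suc j} 1≤i (≤′-step i≤′j) j<n B∈
    with bar-ancestor 1≤i i≤′j (≤-trans (n≤1+n j) j<n) B∈
  ... | C , C∈ , B⊆C with bar-parent (≤-trans 1≤i (≤′⇒≤ i≤′j)) j<n C∈
  ...   | D , D∈ , C⊆D = D , D∈ , ⊆B-trans B⊆C C⊆D

  bar-end≤start : ∀ {i B B' c} → 1 ≤ i → i ≤ n → B' ∈ bars i → B ∈ bars i → c ∈B B →
    end B' ≤ c → end B' ≤ start B
  bar-end≤start {B = B} {B'} {c} 1≤i i≤n B'∈ B∈ (B≤c , c<B) B'≤c with end B' ≤? start B
  ... | yes B'≤B = B'≤B
  ... | no B'≰B with bar-last-column 1≤i i≤n B'∈
  ...   | x , sx≡B' , xB' = ⊥-elim (<⇒≱ c<B (subst (λ D → end D ≤ c) B'≡B B'≤c))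
    where
    xB : x ∈B B
    xB = ≤-pred (subst (start B <_) (sym sx≡B') (≰⇒> B'≰B)) ,
         <-trans (subst (_≤ c) (sym sx≡B') B'≤c) c<B
    B'≡B : B' ≡ B
    B'≡B = intervals-disjoint B'∈ B∈ xB' xB

  -- vacuous when i = n + 1, which is how the top row is handled uniformly
  SharedBar : ℕ → ℕ → ℕ → Set
  SharedBar i c c' = i ≤ n → Σ Bar λ D → D ∈ bars i × c ∈B D × c' ∈B D

  shared-parent : ∀ {i B c c'} → 1 ≤ i → B ∈ bars i → c ∈B B → c' ∈B B → SharedBar (suc i) c c'
  shared-parent 1≤i B∈ cB c'B i<n with bar-parent 1≤i i<n B∈
  ... | D , D∈ , B⊆D = D , D∈ , ∈B-⊆B cB B⊆D , ∈B-⊆B c'B B⊆D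

  InParentOf : ℕ → ℕ → Bar → Set
  InParentOf c i B = Any (λ D → c ∈B D × B ⊆B D) (bars (suc i))

  LeftInParent : ℕ → ℕ → Bar → Set
  LeftInParent c i B = end B ≤ c × InParentOf c i B

  leftInParent? : ∀ c i → Decidable (LeftInParent c i)
  leftInParent? c i B = (end B ≤? c) ×-dec any? (λ D → (c ∈B? D) ×-dec (B ⊆B? D)) (bars (suc i))

  in-own-parent : ∀ {i B c} → 1 ≤ i → i < n → B ∈ bars i → c ∈B B → InParentOf c i B
  in-own-parent 1≤i i<n B∈ cB with bar-parent 1≤i i<n B∈
  ... | D , D∈ , B⊆D = lose D∈ (∈B-⊆B cB B⊆D , B⊆D)

  in-parent-transfer : ∀ {i c c' B} → i < n → SharedBar (suc i) c c' →
    InParentOf c i B → InParentOf c' i B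
  in-parent-transfer i<n shared inParent with find inParent | shared i<n
  ... | D , D∈ , cD , B⊆D | E , E∈ , cE , c'E =
    lose D∈ (subst (_ ∈B_) (intervals-disjoint E∈ D∈ cE cD) c'E , B⊆D)

  e-mono : ∀ {i c c'} → i ≤ n → c ≤ c' → SharedBar (suc i) c c' → e c i ≤ e c' i
  e-mono {i} i≤n c≤c' shared with i ≟ n
  ... | yes refl = length-filter-mono _ _ (bars n) (λ _ B≤c → ≤-trans B≤c c≤c')
  ... | no i≢n = length-filter-mono _ _ (bars i)
          (λ _ (B≤c , inParent) →
            ≤-trans B≤c c≤c' , in-parent-transfer (≤∧≢⇒< i≤n i≢n) shared inParent)

  e-mono-strict : ∀ {i c c' B} → 1 ≤ i → i ≤ n → c ≤ c' → SharedBar (suc i) c c' →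
    B ∈ bars i → c ∈B B → ¬ (c' ∈B B) → e c i < e c' i
  e-mono-strict {i} {c} {c'} {B} 1≤i i≤n c≤c' shared B∈ (B≤c , c<B) c'∉B with i ≟ n
  ... | yes refl = length-filter-< _ _ (bars n) (λ _ B≤c → ≤-trans B≤c c≤c') B∈ B≤c' (<⇒≱ c<B)
    where B≤c' = ≮⇒≥ (λ c'<B → c'∉B (≤-trans B≤c c≤c' , c'<B))
  ... | no i≢n = length-filter-< _ _ (bars i)
          (λ _ (B≤c , inParent) → ≤-trans B≤c c≤c' , in-parent-transfer i<n shared inParent)
          B∈ (B≤c' , in-parent-transfer i<n shared (in-own-parent 1≤i i<n B∈ (B≤c , c<B)))
          (λ (B≤c , _) → <⇒≱ c<B B≤c)
    where
    i<n = ≤∧≢⇒< i≤n i≢n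
    B≤c' = ≮⇒≥ (λ c'<B → c'∉B (≤-trans B≤c c≤c' , c'<B))

  e-le-within-bar : ∀ {i B c c'} → 1 ≤ i → i ≤ n → B ∈ bars i → c ∈B B → c' ∈B B → e c i ≤ e c' i
  e-le-within-bar {i} 1≤i i≤n B∈ cB c'B with i ≟ n
  ... | yes refl = length-filter-mono _ _ (bars n)
          (λ B'∈ B'≤c → ≤-trans (bar-end≤start 1≤i i≤n B'∈ B∈ cB B'≤c) (proj₁ c'B))
  ... | no i≢n = length-filter-mono _ _ (bars i)
          (λ B'∈ (B'≤c , inParent) → ≤-trans (bar-end≤start 1≤i i≤n B'∈ B∈ cB B'≤c) (proj₁ c'B) ,
            in-parent-transfer (≤∧≢⇒< i≤n i≢n) (shared-parent 1≤i B∈ cB c'B) inParent)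

  e-const-above : ∀ {i j B c c'} → 1 ≤ i → i ≤ j → j ≤ n → B ∈ bars i → c ∈B B → c' ∈B B →
    e c j ≡ e c' j
  e-const-above 1≤i i≤j j≤n B∈ cB c'B with bar-ancestor 1≤i (≤⇒≤′ i≤j) j≤n B∈
  ... | D , D∈ , B⊆D =
    ≤-antisym (e-le-within-bar 1≤j j≤n D∈ cD c'D) (e-le-within-bar 1≤j j≤n D∈ c'D cD)
    where
    1≤j = ≤-trans 1≤i i≤j
    cD = ∈B-⊆B cB B⊆D
    c'D = ∈B-⊆B c'B B⊆D

  e-lex-mono-within : ∀ {r k c c'} → r ≤′ k → k ≤ n → 1 ≤ c → c ≤ c' → c' ≤ m →
    SharedBar (suc k) c c' → (∀ i → r < i → i ≤ k → e c i ≡ e c' i) → e c r ≤ e c' r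
  e-lex-mono-within ≤′-refl k≤n _ c≤c' _ shared _ = e-mono k≤n c≤c' shared
  e-lex-mono-within {k = suc k} {c} {c'} (≤′-step r≤′k) k<n 1≤c c≤c' c'≤m shared agree
    with column-bar (s≤s z≤n) k<n 1≤c (≤-trans c≤c' c'≤m)
  ... | B , B∈ , cB with c' ∈B? B
  ...   | yes c'B = e-lex-mono-within r≤′k (≤-trans (n≤1+n k) k<n) 1≤c c≤c' c'≤m
                      (λ _ → B , B∈ , cB , c'B) (λ i r<i i≤k → agree i r<i (m≤n⇒m≤1+n i≤k))
  ...   | no c'∉B = ⊥-elim (<-irrefl (agree (suc k) (s≤s (≤′⇒≤ r≤′k)) ≤-refl)
                      (e-mono-strict (s≤s z≤n) k<n c≤c' shared B∈ cB c'∉B))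

  e-lex-mono : ∀ {r c c'} → r ≤ n → 1 ≤ c → c ≤ c' → c' ≤ m →
    (∀ i → r < i → i ≤ n → e c i ≡ e c' i) → e c r ≤ e c' r
  e-lex-mono r≤n 1≤c c≤c' c'≤m =
    e-lex-mono-within (≤⇒≤′ r≤n) ≤-refl 1≤c c≤c' c'≤m (λ n<n → ⊥-elim (1+n≰n n<n))

  no-e-strictly-between : ∀ {r p c'} → suc r ≤ n → suc p ≤ m → 1 ≤ c' → c' ≤ m →
    (∀ i → r < i → i ≤ n → e c' i ≡ e p i) → e p r < e c' r →
    (∀ i → suc r < i → i ≤ n → e p i ≡ e (suc p) i) → e p (suc r) < e (suc p) (suc r) → ⊥
  no-e-strictly-between {r} {p} {c'} r<n p<m 1≤c' c'≤m c'≈p p<c' p≈p+1 p<p+1 with c' ≤? p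
  ... | yes c'≤p = <⇒≱ p<c' (e-lex-mono (<⇒≤ r<n) 1≤c' c'≤p (<⇒≤ p<m) c'≈p)
  ... | no c'≰p = <⇒≱ p<p+1 (begin
      e (suc p) (suc r) ≤⟨ e-lex-mono r<n (s≤s z≤n) (≰⇒> c'≰p) c'≤m p+1≈c' ⟩
      e c' (suc r)      ≡⟨ c'≈p (suc r) ≤-refl r<n ⟩
      e p (suc r)       ∎)
    where
    open ≤-Reasoning
    p+1≈c' : ∀ i → suc r < i → i ≤ n → e (suc p) i ≡ e c' i
    p+1≈c' i r+1<i i≤n =
      trans (sym (p≈p+1 i r+1<i i≤n)) (sym (c'≈p i (<-trans (n<1+n r) r+1<i) i≤n))

  e-below-top : ∀ {c i} → i ≢ n → e c i ≡ length (filter (leftInParent? c i) (bars i))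
  e-below-top {c} {i} i≢n with i ≟ n
  ... | yes i≡n = ⊥-elim (i≢n i≡n)
  ... | no _ = refl

  e<l : ∀ {r P c} → 1 ≤ r → r < n → P ∈ bars (suc r) → c ∈B P → 1 ≤ c → c ≤ m → e c r < l r P
  e<l {r} {P} {c} 1≤r r<n P∈ cP 1≤c c≤m with column-bar 1≤r (<⇒≤ r<n) 1≤c c≤m
  ... | B , B∈ , cB = subst (_< l r P) (sym (e-below-top (<⇒≢ r<n)))
        (length-filter-< (leftInParent? c r) (λ B' → B' ⊆B? P) (bars r)
          inP B∈ B⊆P (λ (B≤c , _) → <⇒≱ (proj₂ cB) B≤c))
    where
    inP : ∀ {B'} → B' ∈ bars r → LeftInParent c r B' → B' ⊆B P
    inP _ (_ , inParent) with find inParent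
    ... | D , D∈ , cD , B'⊆D = subst (_ ⊆B_) (intervals-disjoint D∈ P∈ cD cP) B'⊆D
    B⊆P : B ⊆B P
    B⊆P with bar-parent 1≤r r<n B∈
    ... | D , D∈ , B⊆D = subst (B ⊆B_) (intervals-disjoint D∈ P∈ (∈B-⊆B cB B⊆D) cP) B⊆D

  l≤suc-e-last : ∀ {r Q q} → 1 ≤ r → r < n → Q ∈ bars (suc r) → suc q ≡ end Q → q ∈B Q →
    l r Q ≤ suc (e q r)
  l≤suc-e-last {r} {Q} {q} 1≤r r<n Q∈ q+1≡Q qQ = begin
    l r Q
      ≤⟨ length-filter-⊎ (λ B → B ⊆B? Q) (leftInParent? q r) (λ B → end B ≟ suc q) (bars r) split ⟩
    length (filter (leftInParent? q r) (bars r)) + length (filter (λ B → end B ≟ suc q) (bars r))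
      ≤⟨ +-monoʳ-≤ _ (intervals-end-unique (suc q) (row-pos r 1≤r (<⇒≤ r<n))) ⟩
    length (filter (leftInParent? q r) (bars r)) + 1
      ≡⟨ +-comm _ 1 ⟩
    suc (length (filter (leftInParent? q r) (bars r)))
      ≡⟨ cong suc (sym (e-below-top (<⇒≢ r<n))) ⟩
    suc (e q r) ∎
    where
    open ≤-Reasoning
    split : ∀ {B} → B ∈ bars r → B ⊆B Q → LeftInParent q r B ⊎ end B ≡ suc q
    split {B} _ B⊆Q with end B ≤? q
    ... | yes B≤q = inj₁ (B≤q , lose Q∈ (qQ , B⊆Q))
    ... | no B≰q = inj₂ (≤-antisym (subst (end B ≤_) (sym q+1≡Q) (proj₂ B⊆Q)) (≰⇒> B≰q))

  CommonBar : ℕ → Bar → Bar → Set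
  CommonBar i B B' = i ≤ n → Σ Bar λ D → D ∈ bars i × B ⊆B D × B' ⊆B D

  l-antitone : Admissible → ∀ {r P Q} → 1 ≤ r → r < n → P ∈ bars (suc r) → Q ∈ bars (suc r) →
    end P ≤ start Q → CommonBar (suc (suc r)) P Q → l r Q ≤ l r P
  l-antitone adm {r} {P} {Q} 1≤r r<n P∈ Q∈ P≤Q common
    with bar-last-column (s≤s z≤n) r<n P∈ | bar-last-column (s≤s z≤n) r<n Q∈
  ... | p , p+1≡P , pP | q , q+1≡Q , qQ = ≮⇒≥ λ lP<lQ →
    let (c' , 1≤c' , c'≤m , c'≡v) = adm q 1≤q q≤m v (v≤eq lP<lQ)
    in no-e-strictly-between r<n (≤-trans p<q q≤m) 1≤c' c'≤m
         (λ i r<i i≤n → trans (c'≡v i (≤-trans 1≤r (<⇒≤ r<i)) i≤n) (truncateAt-> r<i))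
         (subst (e p r <_) (sym (trans (c'≡v r 1≤r r≤n) (truncateAt-≡ {r} {l r P} {e p})))
           (e<l 1≤r r<n P∈ pP 1≤p p≤m))
         (agree-above (n≤1+n p) p<q)
         (e-mono-strict (s≤s z≤n) r<n (n≤1+n p) (shared (n≤1+n p) p<q) P∈ pP
           (λ (_ , p+1<P) → <-irrefl p+1≡P p+1<P))
    where
    r≤n = <⇒≤ r<n
    p<q : p < q
    p<q = ≤-trans (≤-reflexive p+1≡P) (≤-trans P≤Q (proj₁ qQ))
    q≤m : q ≤ m
    q≤m = ≤-pred (subst (_≤ suc m) (sym q+1≡Q) (bar-end (s≤s z≤n) r<n Q∈))
    1≤p : 1 ≤ p
    1≤p = ≤-trans (intervals-start P∈) (proj₁ pP)
    1≤q = ≤-trans 1≤p (<⇒≤ p<q)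
    p≤m = ≤-trans (<⇒≤ p<q) q≤m

    shared : ∀ {x} → p ≤ x → x ≤ q → SharedBar (suc (suc r)) p x
    shared p≤x x≤q r+1<n =
      let (D , D∈ , P⊆D , Q⊆D) = common r+1<n
          pD = ∈B-⊆B pP P⊆D
      in D , D∈ , pD , ∈B-between pD (∈B-⊆B qQ Q⊆D) p≤x x≤q

    agree-above : ∀ {x} → p ≤ x → x ≤ q → ∀ i → suc r < i → i ≤ n → e p i ≡ e x i
    agree-above p≤x x≤q i r+1<i i≤n =
      let (D , D∈ , pD , xD) = shared p≤x x≤q (≤-trans r+1<i i≤n)
      in e-const-above (s≤s z≤n) r+1<i i≤n D∈ pD xD

    v : ℕ → ℕ
    v = truncateAt r (l r P) (e p)

    v≤eq : l r P < l r Q → ∀ i → 1 ≤ i → i ≤ n → v i ≤ e q i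
    v≤eq lP<lQ i _ i≤n with <-cmp i r
    ... | tri< _ _ _ = z≤n
    ... | tri≈ _ refl _ = ≤-pred (≤-trans lP<lQ (l≤suc-e-last 1≤r r<n Q∈ q+1≡Q qQ))
    ... | tri> _ _ r<i = ep≤eq (m≤n⇒m<n∨m≡n r<i)
      where
      ep≤eq : suc r < i ⊎ suc r ≡ i → e p i ≤ e q i
      ep≤eq (inj₁ r+1<i) = ≤-reflexive (agree-above (<⇒≤ p<q) ≤-refl i r+1<i i≤n)
      ep≤eq (inj₂ refl) = e-mono r<n (<⇒≤ p<q) (shared (<⇒≤ p<q) ≤-refl)

l-antitone-top : ∀ {n m} (𝓑 : BarCode n m) → BarCode.Admissible 𝓑 →
  2 ≤ n → Linked _≥_ (map (BarCode.l 𝓑 (n ∸ 1)) (BarCode.bars 𝓑 n))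
l-antitone-top {suc (suc k)} 𝓑 adm (s≤s (s≤s z≤n)) =
  linked-map (l (suc k)) (bars (suc (suc k))) intervals-sorted
  (λ P∈ Q∈ P≤Q → l-antitone adm (s≤s z≤n) ≤-refl P∈ Q∈ P≤Q (λ n+1≤n → ⊥-elim (1+n≰n n+1≤n)))
  where
  open BarCode 𝓑
  open BarCodeProperties 𝓑

l-antitone-over : ∀ {n m} (𝓑 : BarCode n m) → BarCode.Admissible 𝓑 → ∀ i → 1 ≤ i → i + 2 ≤ n →
  All (λ D → Linked _≥_ (map (BarCode.l 𝓑 i) (BarCode.barsOver 𝓑 (suc i) D)))
      (BarCode.bars 𝓑 (i + 2))
l-antitone-over 𝓑 adm i 1≤i i+2≤n rewrite +-comm i 2 = tabulate λ {D} D∈ →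
  linked-map (l i) (barsOver (suc i) D)
    (AllPairs.filter⁺ (λ B → B ⊆B? D) (intervals-sorted {1} {row (suc i)}))
    (λ P∈ Q∈ P≤Q →
      let (P∈' , P⊆D) = ∈-filter⁻ (λ B → B ⊆B? D) P∈
          (Q∈' , Q⊆D) = ∈-filter⁻ (λ B → B ⊆B? D) Q∈
      in l-antitone adm 1≤i (≤-trans (n≤1+n _) i+2≤n) P∈' Q∈' P≤Q (λ _ → D , D∈ , P⊆D , Q⊆D))
  where
  open BarCode 𝓑
  open BarCodeProperties 𝓑

mainTheorem2 : ∀ {n m} (𝓑 : BarCode n m) → BarCode.Admissible 𝓑 →
    (2 ≤ n → Linked _≥_ (map (BarCode.l 𝓑 (n ∸ 1)) (BarCode.bars 𝓑 n)))
    × (∀ i → 1 ≤ i → i + 2 ≤ n →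
        All (λ D → Linked _≥_ (map (BarCode.l 𝓑 i) (BarCode.barsOver 𝓑 (suc i) D)))
            (BarCode.bars 𝓑 (i + 2)))
mainTheorem2 𝓑 adm = l-antitone-top 𝓑 adm , l-antitone-over 𝓑 adm
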